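{- Let $P_n$ be the path of order $n\ge 3$, $G_1,G_2$ disjoint copies of $P_n$, and $f:V(G_1)\to V(G_2)$ a function with $|\mathrm{Range}(f)|=s$, where $1<s<n$. Then $2\le Z(C(P_n,f))\le s+1$. Moreover, both bounds are sharp: each bound is attained by $C(P_n,f)$ for some $n\ge 3$ and some function $f$ with $1<|\mathrm{Range}(f)|<n$.
   Context: Zero forcing: color each vertex of a graph $H$ black or white, with $S$ the initial set of black vertices. The color-change rule turns a white vertex $u_2$ black if $u_2$ is the only white neighbor of some black vertex $u_1$. $S$ is a zero forcing set of $H$ if all vertices become black after finitely many applications of the rule. $Z(H)$ is the minimum size of a zero forcing set of $H$. Functigraph: given disjoint copies $G_1,G_2$ of $G$ and $f:V(G_1)\to V(G_2)$, $C(G,f)$ has vertex set $V(G_1)\cup V(G_2)$ and edge set $E(G_1)\cup E(G_2)\cup\{uv \mid v=f(u)\}$. -}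

module Defs where

open import Level using (0ℓ)
open import Data.Nat using (ℕ; suc; _+_; _≤_; _<_)
open import Data.Fin using (Fin; toℕ; splitAt)
open import Data.Fin.Properties using (any?; _≟_)
open import Data.Fin.Subset using (Subset; _∈_; ∣_∣)
open import Data.Vec using (tabulate)
open import Data.Sum using (_⊎_; inj₁; inj₂)
open import Data.Product using (Σ; _×_; _,_)
open import Data.Empty using (⊥)
open import Relation.Nullary using (¬_; does)
open import Relation.Binary.PropositionalEquality using (_≡_)

record Graph : Set₁ where
  field
    order : ℕ
    Adj   : Fin order → Fin order → Set
open Graph public

PathAdj : {n : ℕ} → Fin n → Fin n → Set
PathAdj u v = (suc (toℕ u) ≡ toℕ v) ⊎ (suc (toℕ v) ≡ toℕ u)

-- Functigraph C(G,f) for a graph on Fin n with adjacency A.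
-- Vertices Fin (n + n): the first n (inj₁ via splitAt) form G₁, the last n form G₂.
FAdj : {n : ℕ} → (Fin n → Fin n → Set) → (Fin n → Fin n) →
       Fin n ⊎ Fin n → Fin n ⊎ Fin n → Set
FAdj A f (inj₁ u) (inj₁ v) = A u v
FAdj A f (inj₂ u) (inj₂ v) = A u v
FAdj A f (inj₁ u) (inj₂ v) = f u ≡ v
FAdj A f (inj₂ v) (inj₁ u) = f u ≡ v

Functigraph : (n : ℕ) → (Fin n → Fin n → Set) → (Fin n → Fin n) → Graph
Functigraph n A f = record
  { order = n + n
  ; Adj   = λ x y → FAdj A f (splitAt n x) (splitAt n y) }

CPath : (n : ℕ) → (Fin n → Fin n) → Graph
CPath n f = Functigraph n PathAdj f

Range : {n : ℕ} → (Fin n → Fin n) → Subset n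
Range f = tabulate (λ v → does (any? (λ u → f u ≟ v)))

rangeSize : {n : ℕ} → (Fin n → Fin n) → ℕ
rangeSize f = ∣ Range f ∣

-- Vertices eventually black when starting from black set S and repeatedly
-- applying the color-change rule (least set closed under the rule).
data Black (H : Graph) (S : Subset (order H)) : Fin (order H) → Set where
  initial : ∀ {v} → v ∈ S → Black H S v
  force   : ∀ {u v} → Black H S u → Adj H u v →
            (∀ w → Adj H u w → ¬ (w ≡ v) → Black H S w) →
            Black H S v

IsZeroForcingSet : (H : Graph) → Subset (order H) → Set
IsZeroForcingSet H S = ∀ v → Black H S v

IsZ : Graph → ℕ → Set
IsZ H k = Σ (Subset (order H)) (λ S → IsZeroForcingSet H S × ∣ S ∣ ≡ k)
        × (∀ S → IsZeroForcingSet H S → k ≤ ∣ S ∣)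

-- A single black vertex cannot force C(Pₙ,f) when f is not constant. A vertex with two
-- neighbours forces nothing on its own; the only other vertices are the two ends of the
-- copy G₂ of Pₙ, and from such an end forcing only runs along G₂ up to the nearest point of
-- Range f, where it stalls: that point has a preimage in G₁ and, f being non-constant,
-- a further neighbour in G₂. Conversely, let m be the least element of Range f and take
-- a₀, b₀ and Range f ∖ {m} as black. No vertex of G₁ is mapped below m, so b₀ forces
-- G₂ up to m; now all of Range f is black, so a₀ forces along G₁, and finally b₀
-- forces all of G₂. The sharpness examples on P₃ are checked by running the
-- colour-change rule and, for minimality, by exhausting all subsets of vertices.

module Submission where

open import Defs
open import Data.Nat as ℕ using (ℕ; zero; suc; _+_; _≤_; _<_; z≤n; s≤s; _≤?_)
open import Data.Nat.Properties
  using (≤-refl; ≤-trans; ≤-reflexive; ≤-antisym; <⇒≤; <⇒≱; <-asym; 1+n≰n; ≤∧≢⇒<; ≰⇒>; ≤-pred;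
         n≤1+n; +-monoʳ-≤; +-suc; 1+n≢n; module ≤-Reasoning)
open import Data.Fin as Fin using (Fin; #_; toℕ; fromℕ<; inject₁; splitAt; join; _↑ˡ_; _↑ʳ_)
open import Data.Fin.Properties
  using (any?; all?; _≟_; toℕ-injective; toℕ-inject₁; toℕ<n;
         splitAt-join; join-splitAt; ≤-totalOrder)
open import Data.Fin.Induction using (<-wellFounded)
open import Data.Fin.Subset
  using (Subset; _∈_; _∉_; _⊆_; ∣_∣; ⁅_⁆; _∪_; _-_; Nonempty; inside; outside)
open import Data.Fin.Subset.Properties
  using (_∈?_; x∈⁅x⁆; x∈⁅y⁆⇒x≡y; ∣⁅x⁆∣≡1; p⊆q⇒∣p∣≤∣q∣; ∣p∣≤n; x∈p∪q⁺;
         x∈p∧x≢y⇒x∈p-y; x∈p⇒∣p-x∣<∣p∣; anySubset?)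
open import Data.Vec using (tabulate; lookup; _∷_; []; _++_)
open import Data.Vec.Properties using ([]=⇒lookup; lookup⇒[]=; lookup∘tabulate; lookup-++ˡ; lookup-++ʳ)
open import Data.List using (allFin)
import Data.List.Relation.Unary.All as ListAll
open import Data.List.Membership.Propositional.Properties using (∈-allFin)
open import Data.Sum using (_⊎_; inj₁; inj₂)
open import Data.Sum.Properties using (≡-dec; inj₁-injective; inj₂-injective)
open import Data.Product using (Σ; ∃; _×_; _,_; proj₁)
open import Data.Empty using (⊥; ⊥-elim)
open import Data.Unit using (tt)
open import Function using (_∘_)
open import Induction.WellFounded using (module All)
open import Relation.Nullary using (¬_; Dec; yes; no; does; contradiction)
open import Relation.Nullary.Decidable
  using (_×-dec_; _⊎-dec_; _→-dec_; ¬?; True; False; toWitness; toWitnessFalse; decidable-stable; dec-true)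
open import Relation.Unary using (Decidable)
open import Relation.Binary.PropositionalEquality

private
  variable
    m n : ℕ

module _ {P : Fin n → Set} (P? : Decidable P) where

  ∈-tabulate-does⁺ : ∀ {x} → P x → x ∈ tabulate (λ y → does (P? y))
  ∈-tabulate-does⁺ {x} px =
    lookup⇒[]= x _ (trans (lookup∘tabulate (λ y → does (P? y)) x) (dec-true (P? x) px))

  ∈-tabulate-does⁻ : ∀ {x} → x ∈ tabulate (λ y → does (P? y)) → P x
  ∈-tabulate-does⁻ {x} x∈ with P? x | trans (sym (lookup∘tabulate (λ y → does (P? y)) x)) ([]=⇒lookup x∈)
  ... | yes px | _ = px
  ... | no _   | ()

∈-++⁺ˡ : ∀ {p : Subset m} {x} (q : Subset n) → x ∈ p → x ↑ˡ n ∈ p ++ q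
∈-++⁺ˡ {p = p} {x} q x∈p = lookup⇒[]= _ _ (trans (lookup-++ˡ p q x) ([]=⇒lookup x∈p))

∈-++⁺ʳ : ∀ (p : Subset m) {q : Subset n} {x} → x ∈ q → m ↑ʳ x ∈ p ++ q
∈-++⁺ʳ p {q} {x} x∈q = lookup⇒[]= _ _ (trans (lookup-++ʳ p q x) ([]=⇒lookup x∈q))

∣p++q∣≡∣p∣+∣q∣ : (p : Subset m) (q : Subset n) → ∣ p ++ q ∣ ≡ ∣ p ∣ + ∣ q ∣
∣p++q∣≡∣p∣+∣q∣ []            q = refl
∣p++q∣≡∣p∣+∣q∣ (inside  ∷ p) q = cong suc (∣p++q∣≡∣p∣+∣q∣ p q)
∣p++q∣≡∣p∣+∣q∣ (outside ∷ p) q = ∣p++q∣≡∣p∣+∣q∣ p q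

∣p∪q∣≤∣p∣+∣q∣ : (p q : Subset n) → ∣ p ∪ q ∣ ≤ ∣ p ∣ + ∣ q ∣
∣p∪q∣≤∣p∣+∣q∣ []            []            = z≤n
∣p∪q∣≤∣p∣+∣q∣ (inside  ∷ p) (inside  ∷ q) =
  s≤s (≤-trans (∣p∪q∣≤∣p∣+∣q∣ p q) (+-monoʳ-≤ ∣ p ∣ (n≤1+n ∣ q ∣)))
∣p∪q∣≤∣p∣+∣q∣ (inside  ∷ p) (outside ∷ q) = s≤s (∣p∪q∣≤∣p∣+∣q∣ p q)
∣p∪q∣≤∣p∣+∣q∣ (outside ∷ p) (inside  ∷ q) =
  ≤-trans (s≤s (∣p∪q∣≤∣p∣+∣q∣ p q)) (≤-reflexive (sym (+-suc ∣ p ∣ ∣ q ∣)))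
∣p∪q∣≤∣p∣+∣q∣ (outside ∷ p) (outside ∷ q) = ∣p∪q∣≤∣p∣+∣q∣ p q

x∈p⇒⁅x⁆⊆p : ∀ {p : Subset n} {x} → x ∈ p → ⁅ x ⁆ ⊆ p
x∈p⇒⁅x⁆⊆p {x = x} x∈p y∈⁅x⁆ = subst (_∈ _) (sym (x∈⁅y⁆⇒x≡y x y∈⁅x⁆)) x∈p

x∈p⇒0<∣p∣ : ∀ {p : Subset n} {x} → x ∈ p → 0 < ∣ p ∣
x∈p⇒0<∣p∣ {x = x} x∈p = subst (_≤ _) (∣⁅x⁆∣≡1 x) (p⊆q⇒∣p∣≤∣q∣ (x∈p⇒⁅x⁆⊆p x∈p))

p⊆⁅x⁆⇒∣p∣≤1 : ∀ {p : Subset n} {x} → p ⊆ ⁅ x ⁆ → ∣ p ∣ ≤ 1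
p⊆⁅x⁆⇒∣p∣≤1 {x = x} p⊆⁅x⁆ = subst (_ ≤_) (∣⁅x⁆∣≡1 x) (p⊆q⇒∣p∣≤∣q∣ p⊆⁅x⁆)

∣p∣≤1∧x∈p∧y∈p⇒x≡y : ∀ {p : Subset n} {x y} → ∣ p ∣ ≤ 1 → x ∈ p → y ∈ p → x ≡ y
∣p∣≤1∧x∈p∧y∈p⇒x≡y {x = x} {y} ∣p∣≤1 x∈p y∈p with y ≟ x
... | yes y≡x = sym y≡x
... | no  y≢x = contradiction ∣p∣≤1 (<⇒≱ (≤-trans
      (s≤s (x∈p⇒0<∣p∣ (x∈p∧x≢y⇒x∈p-y y∈p y≢x))) (x∈p⇒∣p-x∣<∣p∣ x∈p)))

module _ (f : Fin n → Fin n) where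

  ∈-Range⁺ : ∀ u → f u ∈ Range f
  ∈-Range⁺ u = ∈-tabulate-does⁺ (λ v → any? (λ u → f u ≟ v)) (u , refl)

  ∈-Range⁻ : ∀ {v} → v ∈ Range f → ∃ λ u → f u ≡ v
  ∈-Range⁻ = ∈-tabulate-does⁻ (λ v → any? (λ u → f u ≟ v))

  constant⇒rangeSize≤1 : ∀ c → (∀ u → f u ≡ c) → rangeSize f ≤ 1
  constant⇒rangeSize≤1 c fu≡c = p⊆⁅x⁆⇒∣p∣≤1 λ v∈R →
    let u , fu≡v = ∈-Range⁻ v∈R in subst (_∈ ⁅ c ⁆) (trans (sym (fu≡c u)) fu≡v) (x∈⁅x⁆ c)

Forces : (H : Graph) → (Fin (order H) → Set) → Fin (order H) → Fin (order H) → Set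
Forces H T u v = T u × Adj H u v × (∀ w → Adj H u w → ¬ w ≡ v → T w)

ForcingClosed : (H : Graph) → (Fin (order H) → Set) → Set
ForcingClosed H T = ∀ u v → Forces H T u v → T v

module _ {H : Graph} {S : Subset (order H)} where

  Black⊆closed : ∀ {T} → ForcingClosed H T → (∀ v → v ∈ S → T v) → ∀ {v} → Black H S v → T v
  Black⊆closed closed S⊆T (initial v∈S)         = S⊆T _ v∈S
  Black⊆closed closed S⊆T (force bu u~v others) =
    closed _ _ (Black⊆closed closed S⊆T bu , u~v ,
                λ w u~w w≢v → Black⊆closed closed S⊆T (others w u~w w≢v))

  zfs⇒nonempty : IsZeroForcingSet H S → Fin (order H) → Nonempty S
  zfs⇒nonempty zfs v = Black⊆closed (λ _ _ → proj₁) (λ x x∈S → x , x∈S) (zfs v)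

module ForcingDecision (H : Graph) (adj? : ∀ u v → Dec (Adj H u v)) where

  forces? : ∀ (T : Subset (order H)) u v → Dec (Forces H (_∈ T) u v)
  forces? T u v = (u ∈? T) ×-dec adj? u v ×-dec
                  all? (λ w → adj? u w →-dec (¬? (w ≟ v) →-dec (w ∈? T)))

  forcedOrBlack? : ∀ T v → Dec (v ∈ T ⊎ ∃ λ u → Forces H (_∈ T) u v)
  forcedOrBlack? T v = (v ∈? T) ⊎-dec any? (λ u → forces? T u v)

  forcingRound : Subset (order H) → Subset (order H)
  forcingRound T = tabulate (λ v → does (forcedOrBlack? T v))

  forcingRounds : ℕ → Subset (order H) → Subset (order H)
  forcingRounds zero    S = S
  forcingRounds (suc k) S = forcingRound (forcingRounds k S)

  ⊆forcingRounds : ∀ k {S} → S ⊆ forcingRounds k S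
  ⊆forcingRounds zero    v∈S = v∈S
  ⊆forcingRounds (suc k) v∈S = ∈-tabulate-does⁺ (forcedOrBlack? _) (inj₁ (⊆forcingRounds k v∈S))

  forcingRounds⊆Black : ∀ k {S v} → v ∈ forcingRounds k S → Black H S v
  forcingRounds⊆Black zero    v∈S = initial v∈S
  forcingRounds⊆Black (suc k) v∈ with ∈-tabulate-does⁻ (forcedOrBlack? _) v∈
  ... | inj₁ v∈T                   = forcingRounds⊆Black k v∈T
  ... | inj₂ (u , u∈T , u~v , others) =
    force (forcingRounds⊆Black k u∈T) u~v (λ w u~w w≢v → forcingRounds⊆Black k (others w u~w w≢v))

  zfs-byRounds : ∀ k S → True (all? (λ v → v ∈? forcingRounds k S)) → IsZeroForcingSet H S
  zfs-byRounds k S all∈ v = forcingRounds⊆Black k (toWitness all∈ v)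

  closed? : ∀ T → Dec (ForcingClosed H (_∈ T))
  closed? T = all? (λ u → all? (λ v → forces? T u v →-dec (v ∈? T)))

  -- A closed superset of S that misses a vertex shows that S is not zero forcing.
  SizeCertificate : ℕ → ℕ → Subset (order H) → Set
  SizeCertificate k b S =
    b ≤ ∣ S ∣ ⊎ (ForcingClosed H (_∈ forcingRounds k S) × ∃ λ v → v ∉ forcingRounds k S)

  sizeCertificate? : ∀ k b S → Dec (SizeCertificate k b S)
  sizeCertificate? k b S = (b ≤? ∣ S ∣) ⊎-dec
    (closed? (forcingRounds k S) ×-dec any? (λ v → ¬? (v ∈? forcingRounds k S)))

  zfs-size-bySearch : ∀ k b → False (anySubset? (λ S → ¬? (sizeCertificate? k b S))) →
                      ∀ S → IsZeroForcingSet H S → b ≤ ∣ S ∣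
  zfs-size-bySearch k b none S zfs with decidable-stable (sizeCertificate? k b S)
                                          (λ ¬cert → toWitnessFalse none (S , ¬cert))
  ... | inj₁ b≤∣S∣                  = b≤∣S∣
  ... | inj₂ (closed , v , v∉rounds) =
    ⊥-elim (v∉rounds (Black⊆closed closed (λ _ → ⊆forcingRounds k) (zfs v)))

-- Vertices of C(G,f) are handled as Fin n ⊎ Fin n (G₁ on the left), transported along join/splitAt.
module FunctigraphView (A : Fin n → Fin n → Set) (f : Fin n → Fin n) where

  private
    H : Graph
    H = Functigraph n A f

  Forces⊎ : (Fin n ⊎ Fin n → Set) → Fin n ⊎ Fin n → Fin n ⊎ Fin n → Set
  Forces⊎ T p q = T p × FAdj A f p q × (∀ r → FAdj A f p r → ¬ r ≡ q → T r)

  Closed⊎ : (Fin n ⊎ Fin n → Set) → Set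
  Closed⊎ T = ∀ p q → Forces⊎ T p q → T q

  Black⊎ : Subset (n + n) → Fin n ⊎ Fin n → Set
  Black⊎ S p = Black H S (join n n p)

  adj-join : ∀ {p q} → FAdj A f p q → Adj H (join n n p) (join n n q)
  adj-join {p} {q} = subst₂ (FAdj A f) (sym (splitAt-join n n p)) (sym (splitAt-join n n q))

  adj-splitAt : ∀ {p w} → Adj H (join n n p) w → FAdj A f p (splitAt n w)
  adj-splitAt {p} = subst (λ z → FAdj A f z _) (splitAt-join n n p)

  force⊎ : ∀ {S p q} → Forces⊎ (Black⊎ S) p q → Black⊎ S q
  force⊎ {S} {p} {q} (bp , p~q , others) = force bp (adj-join {p} {q} p~q) λ w p~w w≢q →
    subst (Black H S) (join-splitAt n n w)
      (others (splitAt n w) (adj-splitAt {p} p~w)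
              (λ e → w≢q (trans (sym (join-splitAt n n w)) (cong (join n n) e))))

  black⊎⇒zfs : ∀ {S} → (∀ p → Black⊎ S p) → IsZeroForcingSet H S
  black⊎⇒zfs {S} all x = subst (Black H S) (join-splitAt n n x) (all (splitAt n x))

  closed⊎⇒closed : ∀ {T} → Closed⊎ T → ForcingClosed H (T ∘ splitAt n)
  closed⊎⇒closed {T} closed u v (Tu , u~v , others) = closed _ _ (Tu , u~v , λ r u~r r≢v →
    subst T (splitAt-join n n r)
      (others (join n n r) (subst (FAdj A f (splitAt n u)) (sym (splitAt-join n n r)) u~r)
              (λ e → r≢v (trans (sym (splitAt-join n n r)) (cong (splitAt n) e)))))

  -- Starting from p alone, the black vertices never leave T, which misses a vertex.
  Confined : Fin n ⊎ Fin n → Set₁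
  Confined p = Σ (Fin n ⊎ Fin n → Set) λ T → Closed⊎ T × T p × ∃ (¬_ ∘ T)

  confined⇒¬zfs : ∀ {S p} → Confined p → (∀ x → x ∈ S → splitAt n x ≡ p) → ¬ IsZeroForcingSet H S
  confined⇒¬zfs (T , closed , Tp , q , ¬Tq) S⊆p zfs =
    ¬Tq (subst T (splitAt-join n n q)
      (Black⊆closed (closed⊎⇒closed closed) (λ x x∈S → subst T (sym (S⊆p x x∈S)) Tp) (zfs (join n n q))))

  twoNeighbours⇒confined : ∀ {p r₁ r₂} → FAdj A f p r₁ → FAdj A f p r₂ →
                           ¬ r₁ ≡ r₂ → ¬ r₁ ≡ p → ¬ r₂ ≡ p → Confined p
  twoNeighbours⇒confined {p} {r₁} {r₂} p~r₁ p~r₂ r₁≢r₂ r₁≢p r₂≢p =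
    (_≡ p) , closed , refl , r₁ , r₁≢p
    where
      closed : Closed⊎ (_≡ p)
      closed _ q (refl , _ , others) with ≡-dec _≟_ _≟_ r₁ q
      ... | yes refl = contradiction (others r₂ p~r₂ (r₁≢r₂ ∘ sym)) r₂≢p
      ... | no  r₁≢q = contradiction (others r₁ p~r₁ r₁≢q) r₁≢p

FAdj? : {A : Fin n → Fin n → Set} → (∀ u v → Dec (A u v)) → (f : Fin n → Fin n) →
        ∀ p q → Dec (FAdj A f p q)
FAdj? A? f (inj₁ u) (inj₁ v) = A? u v
FAdj? A? f (inj₂ u) (inj₂ v) = A? u v
FAdj? A? f (inj₁ u) (inj₂ v) = f u ≟ v
FAdj? A? f (inj₂ v) (inj₁ u) = f u ≟ v

pathAdj? : (u v : Fin n) → Dec (PathAdj u v)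
pathAdj? u v = (suc (toℕ u) ℕ.≟ toℕ v) ⊎-dec (suc (toℕ v) ℕ.≟ toℕ u)

PathAdj-irrefl : ∀ {i j : Fin n} → PathAdj i j → ¬ j ≡ i
PathAdj-irrefl (inj₁ i+1≡i) refl = 1+n≢n i+1≡i
PathAdj-irrefl (inj₂ i+1≡i) refl = 1+n≢n i+1≡i

first-or-predecessor : (i : Fin n) → toℕ i ≡ 0 ⊎ Σ (Fin n) λ j → suc (toℕ j) ≡ toℕ i
first-or-predecessor Fin.zero    = inj₁ refl
first-or-predecessor (Fin.suc i) = inj₂ (inject₁ i , cong suc (toℕ-inject₁ i))

last-or-successor : (i : Fin n) → suc (toℕ i) ≡ n ⊎ Σ (Fin n) λ j → suc (toℕ i) ≡ toℕ j
last-or-successor {suc zero}    Fin.zero    = inj₁ refl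
last-or-successor {suc (suc n)} Fin.zero    = inj₂ (Fin.suc Fin.zero , refl)
last-or-successor {suc n}       (Fin.suc i) with last-or-successor i
... | inj₁ i+1≡n       = inj₁ (cong suc i+1≡n)
... | inj₂ (j , i+1≡j) = inj₂ (Fin.suc j , cong suc i+1≡j)

path-neighbour : 2 ≤ n → (i : Fin n) → ∃ (PathAdj i)
path-neighbour 2≤n i with first-or-predecessor i | last-or-successor i
... | inj₂ (j , j+1≡i) | _                = j , inj₂ j+1≡i
... | inj₁ _           | inj₂ (j , i+1≡j) = j , inj₁ i+1≡j
... | inj₁ i≡0         | inj₁ i+1≡n       =
  contradiction 2≤n (subst (λ k → ¬ 2 ≤ k) (trans (cong suc (sym i≡0)) i+1≡n) λ { (s≤s ()) })

path-induction : (P : Fin (suc n) → Set) → P Fin.zero →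
                 (∀ w v → suc (toℕ w) ≡ toℕ v → (∀ u → toℕ u ≤ toℕ w → P u) → P v) →
                 ∀ v → P v
path-induction P P₀ step = All.wfRec <-wellFounded _ P λ where
  Fin.zero    _   → P₀
  (Fin.suc v) rec → step (inject₁ v) (Fin.suc v) (cong suc (toℕ-inject₁ v))
                      (λ u u≤v → rec (s≤s (subst (toℕ u ≤_) (toℕ-inject₁ v) u≤v)))

module PathFunctigraph (f : Fin n → Fin n) where

  open FunctigraphView PathAdj f public

  module _ {S : Subset (n + n)} where

    force-along-G₂ : ∀ {w v} → suc (toℕ w) ≡ toℕ v →
                     (∀ u → toℕ u ≤ toℕ w → Black⊎ S (inj₂ u)) →
                     (∀ u → f u ≡ w → Black⊎ S (inj₁ u)) → Black⊎ S (inj₂ v)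
    force-along-G₂ {w} {v} w+1≡v black≤w preimages =
      force⊎ {p = inj₂ w} (black≤w w ≤-refl , inj₁ w+1≡v , others)
      where
        others : ∀ r → FAdj PathAdj f (inj₂ w) r → ¬ r ≡ inj₂ v → Black⊎ S r
        others (inj₁ u) fu≡w         _   = preimages u fu≡w
        others (inj₂ x) (inj₁ w+1≡x) x≢v =
          contradiction (cong inj₂ (toℕ-injective (trans (sym w+1≡x) w+1≡v))) x≢v
        others (inj₂ x) (inj₂ x+1≡w) _   = black≤w x (subst (toℕ x ≤_) x+1≡w (n≤1+n _))

    force-along-G₁ : ∀ {i j} → suc (toℕ i) ≡ toℕ j →
                     (∀ u → toℕ u ≤ toℕ i → Black⊎ S (inj₁ u)) →
                     Black⊎ S (inj₂ (f i)) → Black⊎ S (inj₁ j)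
    force-along-G₁ {i} {j} i+1≡j black≤i black-fi =
      force⊎ {p = inj₁ i} (black≤i i ≤-refl , inj₁ i+1≡j , others)
      where
        others : ∀ r → FAdj PathAdj f (inj₁ i) r → ¬ r ≡ inj₁ j → Black⊎ S r
        others (inj₂ x) fi≡x         _   = subst (Black⊎ S ∘ inj₂) fi≡x black-fi
        others (inj₁ x) (inj₁ i+1≡x) x≢j =
          contradiction (cong inj₁ (toℕ-injective (trans (sym i+1≡x) i+1≡j))) x≢j
        others (inj₁ x) (inj₂ x+1≡i) _   = black≤i x (subst (toℕ x ≤_) x+1≡i (n≤1+n _))

module UpperBound (f : Fin (suc n) → Fin (suc n)) where

  open PathFunctigraph f
  open import Data.List.Extrema (≤-totalOrder (suc n)) using (argmin; f[argmin]≤f[xs])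

  𝟎 : Fin (suc n)
  𝟎 = Fin.zero

  module _ {S : Subset (suc n + suc n)} where

    G₂-black-upto : ∀ K → Black⊎ S (inj₂ 𝟎) →
                    (∀ u → toℕ (f u) < K → Black⊎ S (inj₁ u)) →
                    ∀ v → toℕ v ≤ K → Black⊎ S (inj₂ v)
    G₂-black-upto K b₀ preimages = path-induction _ (λ _ → b₀) step
      where
        step : ∀ w v → suc (toℕ w) ≡ toℕ v → (∀ u → toℕ u ≤ toℕ w → toℕ u ≤ K → Black⊎ S (inj₂ u)) →
               toℕ v ≤ K → Black⊎ S (inj₂ v)
        step w v w+1≡v black≤w v≤K = force-along-G₂ w+1≡v
          (λ u u≤w → black≤w u u≤w (≤-trans u≤w (<⇒≤ w<K)))
          (λ u fu≡w → preimages u (subst (λ x → toℕ x < K) (sym fu≡w) w<K))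
          where
            w<K : toℕ w < K
            w<K = subst (_≤ K) (sym w+1≡v) v≤K

    G₁-black : Black⊎ S (inj₁ 𝟎) → (∀ i → Black⊎ S (inj₂ (f i))) → ∀ i → Black⊎ S (inj₁ i)
    G₁-black a₀ black-range =
      path-induction _ a₀ λ i j i+1≡j black≤i → force-along-G₁ i+1≡j black≤i (black-range i)

  minRange : Fin (suc n)
  minRange = f (argmin f 𝟎 (allFin _))

  minRange≤f : ∀ u → toℕ minRange ≤ toℕ (f u)
  minRange≤f u = ListAll.lookup (f[argmin]≤f[xs] {f = f} 𝟎 (allFin _)) (∈-allFin u)

  G₂-part : Subset (suc n)
  G₂-part = ⁅ 𝟎 ⁆ ∪ (Range f - minRange)

  forcingSet : Subset (suc n + suc n)
  forcingSet = ⁅ 𝟎 ⁆ ++ G₂-part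

  forcingSet-size : ∣ forcingSet ∣ ≤ suc (rangeSize f)
  forcingSet-size = begin
    ∣ ⁅ 𝟎 ⁆ ++ G₂-part ∣                      ≡⟨ ∣p++q∣≡∣p∣+∣q∣ ⁅ 𝟎 ⁆ G₂-part ⟩
    ∣ ⁅ 𝟎 ⁆ ∣ + ∣ G₂-part ∣                   ≡⟨ cong (_+ ∣ G₂-part ∣) (∣⁅x⁆∣≡1 𝟎) ⟩
    suc ∣ ⁅ 𝟎 ⁆ ∪ R∖m ∣                       ≤⟨ s≤s (∣p∪q∣≤∣p∣+∣q∣ ⁅ 𝟎 ⁆ R∖m) ⟩
    suc (∣ ⁅ 𝟎 ⁆ ∣ + ∣ R∖m ∣)                 ≡⟨ cong (λ k → suc (k + ∣ R∖m ∣)) (∣⁅x⁆∣≡1 𝟎) ⟩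
    suc (suc ∣ R∖m ∣)                         ≤⟨ s≤s (x∈p⇒∣p-x∣<∣p∣ (∈-Range⁺ f _)) ⟩
    suc (rangeSize f)                         ∎
    where
      open ≤-Reasoning
      R∖m = Range f - minRange

  forcingSet-zfs : IsZeroForcingSet (CPath (suc n) f) forcingSet
  forcingSet-zfs = black⊎⇒zfs black
    where
      B : Fin (suc n) ⊎ Fin (suc n) → Set
      B = Black⊎ forcingSet

      a₀ : B (inj₁ 𝟎)
      a₀ = initial (∈-++⁺ˡ G₂-part (x∈⁅x⁆ 𝟎))

      b₀ : B (inj₂ 𝟎)
      b₀ = initial (∈-++⁺ʳ ⁅ 𝟎 ⁆ (x∈p∪q⁺ (inj₁ (x∈⁅x⁆ 𝟎))))

      -- Nothing in G₁ is mapped below minRange, so b₀ alone forces G₂ up to minRange.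
      b-min : B (inj₂ minRange)
      b-min = G₂-black-upto (toℕ minRange) b₀
                (λ u fu<min → contradiction (minRange≤f u) (<⇒≱ fu<min)) minRange ≤-refl

      b-range : ∀ i → B (inj₂ (f i))
      b-range i with f i ≟ minRange
      ... | yes fi≡min = subst (B ∘ inj₂) (sym fi≡min) b-min
      ... | no  fi≢min =
        initial (∈-++⁺ʳ ⁅ 𝟎 ⁆ (x∈p∪q⁺ (inj₂ (x∈p∧x≢y⇒x∈p-y (∈-Range⁺ f i) fi≢min))))

      black : ∀ p → B p
      black (inj₁ i) = G₁-black a₀ b-range i
      black (inj₂ v) = G₂-black-upto (suc n) b₀ (λ u _ → G₁-black a₀ b-range u) v (<⇒≤ (toℕ<n v))

module LowerBound (f : Fin n → Fin n) (1<s : 1 < rangeSize f) where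

  open PathFunctigraph f

  2≤n : 2 ≤ n
  2≤n = ≤-trans 1<s (∣p∣≤n (Range f))

  nonconstant : ∀ c → ¬ (∀ u → f u ≡ c)
  nonconstant c fu≡c = <⇒≱ 1<s (constant⇒rangeSize≤1 f c fu≡c)

  BelowRange : Fin n ⊎ Fin n → Set
  BelowRange (inj₁ _) = ⊥
  BelowRange (inj₂ w) = ∀ u → toℕ w ≤ toℕ (f u)

  AboveRange : Fin n ⊎ Fin n → Set
  AboveRange (inj₁ _) = ⊥
  AboveRange (inj₂ w) = ∀ u → toℕ (f u) ≤ toℕ w

  belowRange-closed : Closed⊎ BelowRange
  belowRange-closed (inj₂ w) (inj₁ i) (w≤ , fi≡w , others) with last-or-successor w
  ... | inj₁ w+1≡n       = nonconstant w λ u → toℕ-injective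
        (≤-antisym (≤-pred (subst (toℕ (f u) <_) (sym w+1≡n) (toℕ<n (f u)))) (w≤ u))
  ... | inj₂ (x , w+1≡x) =
    1+n≰n (subst₂ _≤_ (sym w+1≡x) (cong toℕ fi≡w) (others (inj₂ x) (inj₁ w+1≡x) (λ ()) i))
  belowRange-closed (inj₂ w) (inj₂ x) (w≤ , inj₁ w+1≡x , others) u =
    subst (_≤ toℕ (f u)) w+1≡x
      (≤∧≢⇒< (w≤ u) λ w≡fu → others (inj₁ u) (toℕ-injective (sym w≡fu)) (λ ()))
  belowRange-closed (inj₂ w) (inj₂ x) (w≤ , inj₂ x+1≡w , _) u =
    ≤-trans (subst (toℕ x ≤_) x+1≡w (n≤1+n _)) (w≤ u)

  aboveRange-closed : Closed⊎ AboveRange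
  aboveRange-closed (inj₂ w) (inj₁ i) (≤w , fi≡w , others) with first-or-predecessor w
  ... | inj₁ w≡0         = nonconstant w λ u → toℕ-injective
        (≤-antisym (≤w u) (subst (_≤ toℕ (f u)) (sym w≡0) z≤n))
  ... | inj₂ (x , x+1≡w) =
    1+n≰n (subst (_≤ toℕ x) (trans (cong toℕ fi≡w) (sym x+1≡w)) (others (inj₂ x) (inj₂ x+1≡w) (λ ()) i))
  aboveRange-closed (inj₂ w) (inj₂ x) (≤w , inj₁ w+1≡x , _) u =
    ≤-trans (≤w u) (subst (toℕ w ≤_) w+1≡x (n≤1+n _))
  aboveRange-closed (inj₂ w) (inj₂ x) (≤w , inj₂ x+1≡w , others) u =
    ≤-pred (subst (toℕ (f u) <_) (sym x+1≡w)
      (≤∧≢⇒< (≤w u) λ fu≡w → others (inj₁ u) (toℕ-injective fu≡w) (λ ())))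

  confined : ∀ p → Confined p
  confined (inj₁ i) =
    let j , i~j = path-neighbour 2≤n i in
    twoNeighbours⇒confined {r₁ = inj₂ (f i)} {r₂ = inj₁ j} refl i~j (λ ()) (λ ())
                           (PathAdj-irrefl i~j ∘ inj₁-injective)
  confined (inj₂ v) with first-or-predecessor v | last-or-successor v
  ... | inj₁ v≡0 | _ =
    BelowRange , belowRange-closed , (λ u → subst (_≤ toℕ (f u)) (sym v≡0) z≤n) , inj₁ v , λ ()
  ... | inj₂ _ | inj₁ v+1≡n =
    AboveRange , aboveRange-closed ,
    (λ u → ≤-pred (subst (toℕ (f u) <_) (sym v+1≡n) (toℕ<n (f u)))) , inj₁ v , λ ()
  ... | inj₂ (x , x+1≡v) | inj₂ (y , v+1≡y) =
    twoNeighbours⇒confined {r₁ = inj₂ x} {r₂ = inj₂ y} (inj₂ x+1≡v) (inj₁ v+1≡y)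
      (λ { refl → <-asym (≤-reflexive x+1≡v) (≤-reflexive v+1≡y) })
      (PathAdj-irrefl {i = v} (inj₂ x+1≡v) ∘ inj₂-injective)
      (PathAdj-irrefl {i = v} (inj₁ v+1≡y) ∘ inj₂-injective)

  zfs-size≥2 : ∀ S → IsZeroForcingSet (CPath n f) S → 2 ≤ ∣ S ∣
  zfs-size≥2 S zfs with 2 ≤? ∣ S ∣ | zfs⇒nonempty zfs (join n n (inj₁ (fromℕ< (≤-trans (s≤s z≤n) 2≤n))))
  ... | yes 2≤∣S∣ | _       = 2≤∣S∣
  ... | no  2≰∣S∣ | x , x∈S = contradiction zfs (confined⇒¬zfs (confined (splitAt n x)) λ y y∈S →
    cong (splitAt n) (∣p∣≤1∧x∈p∧y∈p⇒x≡y (≤-pred (≰⇒> 2≰∣S∣)) y∈S x∈S))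

f₁ f₂ : Fin 3 → Fin 3
f₁ = lookup (# 0 ∷ # 0 ∷ # 1 ∷ [])
f₂ = lookup (# 0 ∷ # 1 ∷ # 0 ∷ [])

cpathAdj? : (f : Fin n → Fin n) → ∀ u v → Dec (Adj (CPath n f) u v)
cpathAdj? {n} f u v = FAdj? pathAdj? f (splitAt n u) (splitAt n v)

module Search₁ = ForcingDecision (CPath 3 f₁) (cpathAdj? f₁)
module Search₂ = ForcingDecision (CPath 3 f₂) (cpathAdj? f₂)

theorem6p6 :
    ((n : ℕ) → 3 ≤ n → (f : Fin n → Fin n) → 1 < rangeSize f → rangeSize f < n →
      Σ (Subset (order (CPath n f)))
        (λ S → IsZeroForcingSet (CPath n f) S × ∣ S ∣ ≤ suc (rangeSize f))
      × ((S : Subset (order (CPath n f))) → IsZeroForcingSet (CPath n f) S → 2 ≤ ∣ S ∣))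
    × Σ ℕ (λ n → Σ (Fin n → Fin n) (λ f →
        3 ≤ n × 1 < rangeSize f × rangeSize f < n × IsZ (CPath n f) 2))
    × Σ ℕ (λ n → Σ (Fin n → Fin n) (λ f →
        3 ≤ n × 1 < rangeSize f × rangeSize f < n × IsZ (CPath n f) (suc (rangeSize f))))
theorem6p6 = bounds , lower-sharp , upper-sharp
  where
    bounds = λ where
      (suc n) _ f 1<s _ →
        (UpperBound.forcingSet f , UpperBound.forcingSet-zfs f , UpperBound.forcingSet-size f) ,
        LowerBound.zfs-size≥2 f 1<s
    lower-sharp = 3 , f₁ , ≤-refl , ≤-refl , ≤-refl
      , (S₁ , Search₁.zfs-byRounds 5 S₁ tt , refl) , LowerBound.zfs-size≥2 f₁ ≤-refl
      where S₁ = inside ∷ inside ∷ outside ∷ outside ∷ outside ∷ outside ∷ []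
    upper-sharp = 3 , f₂ , ≤-refl , ≤-refl , ≤-refl
      , (S₂ , Search₂.zfs-byRounds 5 S₂ tt , refl) , Search₂.zfs-size-bySearch 5 3 tt
      where S₂ = inside ∷ inside ∷ inside ∷ outside ∷ outside ∷ outside ∷ []
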